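{- Let $w$ be an improper Tribonacci representation of an integer $n$ (a finite word over nonnegative integer digits containing at least one digit greater than $1$), let $m$ be the weight of $w$, and suppose $w$ ends in at least $3m$ zeros. Then the canonization procedure applied to $w$ terminates after a finite number of steps.
   Context: Tribonacci numbers: $T_0=0,T_1=0,T_2=1$, $T_n=T_{n-1}+T_{n-2}+T_{n-3}$ ($n\ge3$). A word $d_k\cdots d_0$ of nonnegative integer digits represents $n=\sum_i d_iT_{i+3}$; words are regarded as padded on the left with as many zeros as needed. It is canonical if all digits are in $\{0,1\}$ and no three consecutive digits are $1$. The improper boundary is the leftmost position holding a digit greater than $1$; the weight of the word is the sum of all digits lying to the right of the last $0$ that precedes the improper boundary. Carrying replaces a factor $d\,x\,y\,z$ (with $x,y,z>0$) by $(d+1)(x-1)(y-1)(z-1)$. The canonization procedure repeatedly does: Step 1: if some three consecutive digits are all positive, apply carrying at the leftmost such triple (which is preceded by a $0$, so $0xyz\mapsto 1(x-1)(y-1)(z-1)$). Step 2: otherwise, let $x>1$ be the digit at the improper boundary; (2a) if it is immediately preceded by $0$, replace the factor $0\,x\,y\,z\,e$ by $1\,(x-2)\,y\,z\,(e+1)$; (2b) if it is preceded by $01$ (then the digit after $x$ is $0$), replace the factor $0\,1\,x\,0\,z\,e$ by $1\,0\,(x-2)\,0\,(z+1)\,(e+1)$. Steps 2a/2b are undefined when $x$ is among the last three digits of the word. The procedure terminates when the current word is canonical. -}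

module Defs where

open import Data.Nat using (ℕ; zero; suc; _+_; _*_; _∸_; _≤_; _<?_; _≟_)
open import Data.List using (List; []; _∷_; _++_; replicate)
open import Data.Nat.ListAction using (sum)
open import Data.List.Relation.Unary.All using (All)
open import Data.List.Relation.Unary.Any using (Any)
open import Data.Maybe using (Maybe; just; nothing)
open import Data.Product using (_×_; ∃)
open import Relation.Nullary using (¬_; yes; no)
open import Relation.Binary.PropositionalEquality using (_≡_)

-- A word d_k ⋯ d_0 is a list of digits, MOST significant digit first
-- (so the head is d_k and the last element is d_0).  Words are regarded
-- as padded on the left with zeros; the procedures below prepend the
-- zeros they need.

Improper : List ℕ → Set
Improper w = Any (λ d → 2 ≤ d) w

data PosTriple : List ℕ → Set where
  here  : ∀ {x y z ds} → 1 ≤ x → 1 ≤ y → 1 ≤ z → PosTriple (x ∷ y ∷ z ∷ ds)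
  there : ∀ {d ds} → PosTriple ds → PosTriple (d ∷ ds)

Canonical : List ℕ → Set
Canonical w = All (λ d → d ≤ 1) w × ¬ PosTriple w

-- Weight: sum of all digits to the right of the last 0 preceding the
-- improper boundary (the leftmost digit > 1).  The accumulator holds the
-- sum of digits seen since the last 0 (the left padding supplies a 0).
-- For words without a digit > 1 the value is irrelevant (0).
weightAcc : ℕ → List ℕ → ℕ
weightAcc acc [] = 0
weightAcc acc (d ∷ ds) with 1 <? d
... | yes _ = acc + sum (d ∷ ds)
... | no _ with d ≟ 0
...   | yes _ = weightAcc 0 ds
...   | no _  = weightAcc (acc + d) ds

weight : List ℕ → ℕ
weight w = weightAcc 0 w

carry : List ℕ → Maybe (List ℕ)
carry (d ∷ suc x ∷ suc y ∷ suc z ∷ ds) = just (suc d ∷ x ∷ y ∷ z ∷ ds)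
carry (d ∷ ds) with carry ds
... | just ds' = just (d ∷ ds')
... | nothing  = nothing
carry [] = nothing

-- Step 2: locate the improper boundary x (leftmost digit > 1), looking at
-- the two digits a b preceding it (the word is given two padding 0's).
--  (2a) b = 0 :           0 x y z e ↦ 1 (x-2) y z (e+1)
--  (2b) a = 0, b = 1, digit after x is 0 :
--                         0 1 x 0 z e ↦ 1 0 (x-2) 0 (z+1) (e+1)
-- Undefined (nothing) when x is among the last three digits, or in the
-- (unreachable after Step 1 fails) situations not covered by 2a/2b.
fix2at : ℕ → ℕ → ℕ → List ℕ → Maybe (List ℕ)
fix2at a zero x (y ∷ z ∷ e ∷ rest) =
  just (a ∷ 1 ∷ (x ∸ 2) ∷ y ∷ z ∷ suc e ∷ rest)
fix2at zero (suc zero) x (zero ∷ z ∷ e ∷ rest) =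
  just (1 ∷ 0 ∷ (x ∸ 2) ∷ 0 ∷ suc z ∷ suc e ∷ rest)
fix2at a b x rest = nothing

fix2 : ℕ → ℕ → List ℕ → Maybe (List ℕ)
fix2 a b [] = nothing
fix2 a b (x ∷ rest) with 1 <? x
... | yes _ = fix2at a b x rest
... | no _ with fix2 b x rest
...   | just r = just (a ∷ r)
...   | nothing = nothing

step : List ℕ → Maybe (List ℕ)
step w with carry (0 ∷ w)
... | just w' = just w'
... | nothing = fix2 0 0 w

data Terminates : List ℕ → Set where
  done : ∀ {w} → Canonical w → Terminates w
  next : ∀ {w w'} → ¬ Canonical w → step w ≡ just w' → Terminates w' → Terminates w

EndsInZeros : ℕ → List ℕ → Set
EndsInZeros k w = ∃ λ u → w ≡ u ++ replicate k 0

-- Every step of the procedure is a local rewrite, and each rewrite lowers the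
-- potential Σ dᵢ·(i+1) (carrying by 2i+2 when the triple ends at position i,
-- Steps 2a and 2b by 2 and 4), so the procedure stops as long as every step is
-- defined.  Step 2 is defined once the improper boundary has three digits to its
-- right.  This is guaranteed by an invariant, for a bound P on the position of
-- the boundary: the boundary never moves left of P, and every positive digit at
-- a position q ≤ P + 1 starts a suffix of digit sum at most q/3; so the boundary
-- digit x ≥ 2 sits at a position ≥ 6.  Initially this holds with P the initial
-- boundary, by the hypothesis on the trailing zeros; it is preserved since the
-- rewrites never increase digit sums and leave digits > 1 only at or to the right
-- of the boundary.
module Submission where

open import Defs
open import Data.Nat using (ℕ; zero; suc; _+_; _*_; _≤_; _<_; z≤n; s≤s; z<s; _≤?_; _<?_)
open import Data.Nat.Properties
open import Data.Nat.Induction using (<-wellFounded)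
open import Data.Nat.ListAction using (sum)
open import Data.Nat.Tactic.RingSolver using (solve-∀)
open import Data.List using (List; []; _∷_; _++_; replicate; length)
open import Data.List.Properties using (length-++; length-replicate; ++-identityʳ)
open import Data.List.Relation.Unary.All using ([]; _∷_) renaming (map to All-map)
open import Data.List.Relation.Unary.All.Properties using (¬Any⇒All¬; All¬⇒¬Any; replicate⁺)
open import Data.List.Relation.Unary.Any using (here; there; any?; tail)
open import Data.Maybe using (just; nothing) renaming (map to Maybe-map)
open import Data.Product using (_×_; _,_; ∃)
open import Data.Sum using (_⊎_; inj₁; inj₂)
open import Data.Unit using (⊤; tt)
open import Data.Empty using (⊥-elim)
open import Function using (_∘_)
open import Induction.WellFounded using (Acc; acc)
open import Relation.Nullary using (¬_; Dec; yes; no)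
open import Relation.Binary.PropositionalEquality using (_≡_; refl; sym; trans; cong; subst)

potential : List ℕ → ℕ
potential []       = 0
potential (d ∷ ds) = d * suc (length ds) + potential ds

potential-zeros : ∀ n {w} → potential (replicate n 0 ++ w) ≡ potential w
potential-zeros zero    = refl
potential-zeros (suc n) = potential-zeros n

<-by : ∀ {m n} k → n ≡ suc (m + k) → m < n
<-by {m} k refl = s≤s (m≤m+n m k)

3*-cancel-< : ∀ {S T L} → T < S → 3 * S ≤ 3 + L → 3 * T ≤ L
3*-cancel-< {S} {T} {L} T<S bound =
  +-cancelˡ-≤ 3 (3 * T) L (subst (_≤ 3 + L) (*-suc 3 T) (≤-trans (*-monoʳ-≤ 3 T<S) bound))

-- The position of a digit is the number of digits to its right.
record TameAt (P d : ℕ) (ds : List ℕ) : Set where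
  constructor tameAt
  field
    boundary : 2 ≤ d → length ds ≤ P
    sparse   : 1 ≤ d → length ds ≤ suc P → 3 * (d + sum ds) ≤ length ds

open TameAt

Tame : ℕ → List ℕ → Set
Tame P []       = ⊤
Tame P (d ∷ ds) = TameAt P d ds × Tame P ds

tame-zero : ∀ {P ds} → TameAt P 0 ds
tame-zero = tameAt (λ ()) (λ ())

tame-one : ∀ {P ds} → 3 * (1 + sum ds) ≤ length ds → TameAt P 1 ds
tame-one bound = tameAt (λ { (s≤s ()) }) (λ _ _ → bound)

tame-low : ∀ {P d ds} → length ds ≤ P → 3 * (d + sum ds) ≤ length ds → TameAt P d ds
tame-low position bound = tameAt (λ _ → position) (λ _ _ → bound)

tame-mono : ∀ {P d d' ds ds'} → d' ≤ d → sum ds' ≤ sum ds → length ds' ≡ length ds →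
            TameAt P d ds → TameAt P d' ds'
tame-mono {P} {d} {d'} {ds} {ds'} d'≤d sum≤ length≡ t =
  tameAt (λ 2≤d' → subst (_≤ P) (sym length≡) (boundary t (≤-trans 2≤d' d'≤d)))
         (λ 1≤d' len → subst (3 * (d' + sum ds') ≤_) (sym length≡)
            (≤-trans (*-monoʳ-≤ 3 (+-mono-≤ d'≤d sum≤))
                     (sparse t (≤-trans 1≤d' d'≤d) (subst (_≤ suc P) length≡ len))))

tame-zeros : ∀ {P w} n → Tame P w → Tame P (replicate n 0 ++ w)
tame-zeros zero    tame = tame
tame-zeros (suc n) tame = tame-zero , tame-zeros n tame

tame-++ : ∀ {P} u {v} → length (u ++ v) ≤ suc P → 3 * sum (u ++ v) ≤ length v →
          Tame P v → Tame P (u ++ v)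
tame-++ []      _   _     tame = tame
tame-++ (d ∷ u) {v} len bound tame =
  tame-low (≤-pred len) (≤-trans bound length-v≤) ,
  tame-++ u (m≤n⇒m≤1+n (≤-pred len)) (≤-trans (*-monoʳ-≤ 3 (m≤n+m _ d)) bound) tame
  where
  length-v≤ : length v ≤ length (u ++ v)
  length-v≤ = subst (length v ≤_) (sym (length-++ u)) (m≤n+m _ _)

infix 4 _⟶_ _↝_

data _⟶_ : List ℕ → List ℕ → Set where
  carrying : ∀ {x y z r} →
             0 ∷ suc x ∷ suc y ∷ suc z ∷ r ⟶ 1 ∷ x ∷ y ∷ z ∷ r
  fix-2a   : ∀ {x y z e r} →
             0 ∷ suc (suc x) ∷ y ∷ z ∷ e ∷ r ⟶ 1 ∷ x ∷ y ∷ z ∷ suc e ∷ r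
  fix-2b   : ∀ {x z e r} →
             0 ∷ 1 ∷ suc (suc x) ∷ 0 ∷ z ∷ e ∷ r ⟶ 1 ∷ 0 ∷ x ∷ 0 ∷ suc z ∷ suc e ∷ r

data _↝_ : List ℕ → List ℕ → Set where
  here  : ∀ {v v'} → v ⟶ v' → v ↝ v'
  there : ∀ {d ds ds'} → ds ↝ ds' → d ∷ ds ↝ d ∷ ds'

-- Abstract, so that type checking never unfolds the solver's large proof terms.
abstract
  carrying-sum : ∀ x y z s → suc x + (suc y + (suc z + s)) ≡ (1 + (x + (y + (z + s)))) + 2
  carrying-sum = solve-∀

  fix-2a-sum : ∀ x y z e s → 1 + (x + (y + (z + (suc e + s)))) ≡ suc (suc x) + (y + (z + (e + s)))
  fix-2a-sum = solve-∀

  fix-2b-sum : ∀ x z e s → 1 + (0 + (x + (0 + (suc z + (suc e + s)))))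
                         ≡ 1 + (suc (suc x) + (0 + (z + (e + s))))
  fix-2b-sum = solve-∀

  carrying-potential : ∀ x y z L m →
    0 * (4 + L) + (suc x * (3 + L) + (suc y * (2 + L) + (suc z * (1 + L) + m)))
    ≡ suc ((1 * (4 + L) + (x * (3 + L) + (y * (2 + L) + (z * (1 + L) + m)))) + (2 * L + 1))
  carrying-potential = solve-∀

  fix-2a-potential : ∀ x y z e L m →
    0 * (5 + L) + (suc (suc x) * (4 + L) + (y * (3 + L) + (z * (2 + L) + (e * (1 + L) + m))))
    ≡ suc ((1 * (5 + L) + (x * (4 + L) + (y * (3 + L) + (z * (2 + L) + (suc e * (1 + L) + m))))) + 1)
  fix-2a-potential = solve-∀

  fix-2b-potential : ∀ x z e L m →
    0 * (6 + L) + (1 * (5 + L) + (suc (suc x) * (4 + L) + (0 * (3 + L)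
      + (z * (2 + L) + (e * (1 + L) + m)))))
    ≡ suc ((1 * (6 + L) + (0 * (5 + L) + (x * (4 + L) + (0 * (3 + L)
      + (suc z * (2 + L) + (suc e * (1 + L) + m)))))) + 3)
  fix-2b-potential = solve-∀

⟶-sum-≤ : ∀ {v v'} → v ⟶ v' → sum v' ≤ sum v
⟶-sum-≤ (carrying {x} {y} {z} {r}) =
  subst (sum (1 ∷ x ∷ y ∷ z ∷ r) ≤_) (sym (carrying-sum x y z (sum r))) (m≤m+n _ 2)
⟶-sum-≤ (fix-2a {x} {y} {z} {e} {r}) = ≤-reflexive (fix-2a-sum x y z e (sum r))
⟶-sum-≤ (fix-2b {x} {z} {e} {r})     = ≤-reflexive (fix-2b-sum x z e (sum r))

⟶-potential : ∀ {v v'} → v ⟶ v' → potential v' < potential v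
⟶-potential (carrying {x} {y} {z} {r}) =
  <-by (2 * length r + 1) (carrying-potential x y z (length r) (potential r))
⟶-potential (fix-2a {x} {y} {z} {e} {r}) =
  <-by 1 (fix-2a-potential x y z e (length r) (potential r))
⟶-potential (fix-2b {x} {z} {e} {r}) =
  <-by 3 (fix-2b-potential x z e (length r) (potential r))

⟶-tame : ∀ {P v v'} → v ⟶ v' → Tame P v → Tame P v'
⟶-tame {P} (carrying {x} {y} {z} {r}) (_ , tx , ty , tz , tr) =
  tameAt (λ { (s≤s ()) }) one-sparse ,
  tame-mono (n≤1+n x) (+-mono-≤ (n≤1+n y) (+-monoˡ-≤ _ (n≤1+n z))) refl tx ,
  tame-mono (n≤1+n y) (+-monoˡ-≤ _ (n≤1+n z)) refl ty ,
  tame-mono (n≤1+n z) ≤-refl refl tz ,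
  tr
  where
  one-sparse : 1 ≤ 1 → 3 + length r ≤ suc P → 3 * sum (1 ∷ x ∷ y ∷ z ∷ r) ≤ 3 + length r
  one-sparse _ len = ≤-trans (*-monoʳ-≤ 3 (⟶-sum-≤ (carrying {x} {y} {z} {r})))
                             (≤-trans (sparse tx (s≤s z≤n) (≤-trans (n≤1+n _) len)) (n≤1+n _))
⟶-tame {P} (fix-2a {x} {y} {z} {e} {r}) (_ , tx , _ , _ , _ , tr) =
  tame-one (≤-trans (*-monoʳ-≤ 3 new≤old) (≤-trans window (n≤1+n _))) ,
  tame-low position (≤-trans (*-monoʳ-≤ 3 (≤-trans (n≤1+n _) new≤old)) window) ,
  tame-++ (y ∷ z ∷ suc e ∷ []) (m≤n⇒m≤1+n position)
          (3*-cancel-< (≤-trans (s≤s (m≤n+m _ x)) new≤old) window) tr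
  where
  position : 3 + length r ≤ P
  position = boundary tx (s≤s (s≤s z≤n))
  window : 3 * sum (0 ∷ suc (suc x) ∷ y ∷ z ∷ e ∷ r) ≤ 3 + length r
  window = sparse tx (s≤s z≤n) (m≤n⇒m≤1+n position)
  new≤old : sum (1 ∷ x ∷ y ∷ z ∷ suc e ∷ r) ≤ sum (0 ∷ suc (suc x) ∷ y ∷ z ∷ e ∷ r)
  new≤old = ⟶-sum-≤ (fix-2a {x} {y} {z} {e} {r})
⟶-tame {P} (fix-2b {x} {z} {e} {r}) (_ , t1 , tx , _ , _ , _ , tr) =
  tame-one (≤-trans (*-monoʳ-≤ 3 new≤old) (≤-trans window (n≤1+n _))) ,
  tame-zero ,
  tame-low position (≤-trans x-sparse (m≤n+m _ 2)) ,
  tame-zero ,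
  tame-low (≤-trans (m≤n+m _ 2) position) z-sparse ,
  tame-low (≤-trans (m≤n+m _ 3) position)
           (3*-cancel-< (m<n+m (suc e + sum r) {suc z} z<s) (≤-trans z-sparse (m≤n+m _ 2))) ,
  tr
  where
  position : 3 + length r ≤ P
  position = boundary tx (s≤s (s≤s z≤n))
  window : 3 * sum (0 ∷ 1 ∷ suc (suc x) ∷ 0 ∷ z ∷ e ∷ r) ≤ 4 + length r
  window = sparse t1 (s≤s z≤n) (s≤s position)
  new≤old : sum (1 ∷ 0 ∷ x ∷ 0 ∷ suc z ∷ suc e ∷ r) ≤ sum (0 ∷ 1 ∷ suc (suc x) ∷ 0 ∷ z ∷ e ∷ r)
  new≤old = ⟶-sum-≤ (fix-2b {x} {z} {e} {r})
  x-sparse : 3 * sum (x ∷ 0 ∷ suc z ∷ suc e ∷ r) ≤ 1 + length r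
  x-sparse = 3*-cancel-< new≤old window
  z-sparse : 3 * sum (suc z ∷ suc e ∷ r) ≤ 1 + length r
  z-sparse = ≤-trans (*-monoʳ-≤ 3 (m≤n+m _ x)) x-sparse

⟶⇒¬Canonical : ∀ {v v'} → v ⟶ v' → ¬ Canonical v
⟶⇒¬Canonical carrying (_ , ¬triple) = ¬triple (there (here (s≤s z≤n) (s≤s z≤n) (s≤s z≤n)))
⟶⇒¬Canonical fix-2a   (_ ∷ s≤s () ∷ _ , _)
⟶⇒¬Canonical fix-2b   (_ ∷ _ ∷ s≤s () ∷ _ , _)

↝-length : ∀ {v v'} → v ↝ v' → length v' ≡ length v
↝-length (here carrying) = refl
↝-length (here fix-2a)   = refl
↝-length (here fix-2b)   = refl
↝-length (there r)       = cong suc (↝-length r)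

↝-sum-≤ : ∀ {v v'} → v ↝ v' → sum v' ≤ sum v
↝-sum-≤ (here r)        = ⟶-sum-≤ r
↝-sum-≤ (there {d} r)   = +-monoʳ-≤ d (↝-sum-≤ r)

↝-potential : ∀ {v v'} → v ↝ v' → potential v' < potential v
↝-potential (here r) = ⟶-potential r
↝-potential (there {d} {ds} r) rewrite ↝-length r = +-monoʳ-< (d * suc (length ds)) (↝-potential r)

↝-tame : ∀ {P v v'} → v ↝ v' → Tame P v → Tame P v'
↝-tame (here r)  tame       = ⟶-tame r tame
↝-tame (there r) (td , tds) = tame-mono ≤-refl (↝-sum-≤ r) (↝-length r) td , ↝-tame r tds

↝⇒¬Canonical : ∀ {v v'} → v ↝ v' → ¬ Canonical v
↝⇒¬Canonical (here r)  = ⟶⇒¬Canonical r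
↝⇒¬Canonical (there r) (_ ∷ digits≤1 , ¬triple) = ↝⇒¬Canonical r (digits≤1 , ¬triple ∘ there)

¬PosTriple-0∷ : ∀ {w} → ¬ PosTriple w → ¬ PosTriple (0 ∷ w)
¬PosTriple-0∷ ¬triple (here () _ _)
¬PosTriple-0∷ ¬triple (there t) = ¬triple t

canonical-zeros : ∀ n {w} → Canonical w → Canonical (replicate n 0 ++ w)
canonical-zeros zero    canonical = canonical
canonical-zeros (suc n) canonical =
  let digits≤1 , ¬triple = canonical-zeros n canonical in z≤n ∷ digits≤1 , ¬PosTriple-0∷ ¬triple

data LeadingTriple : List ℕ → Set where
  leadingTriple : ∀ {x y z r} → LeadingTriple (suc x ∷ suc y ∷ suc z ∷ r)

leadingTriple? : (ds : List ℕ) → Dec (LeadingTriple ds)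
leadingTriple? (suc _ ∷ suc _ ∷ suc _ ∷ _) = yes leadingTriple
leadingTriple? []                          = no λ ()
leadingTriple? (zero ∷ _)                  = no λ ()
leadingTriple? (suc _ ∷ [])                = no λ ()
leadingTriple? (suc _ ∷ zero ∷ _)          = no λ ()
leadingTriple? (suc _ ∷ suc _ ∷ [])        = no λ ()
leadingTriple? (suc _ ∷ suc _ ∷ zero ∷ _)  = no λ ()

leadingTriple-∷ : ∀ {d ds} → 1 ≤ d → LeadingTriple ds → LeadingTriple (d ∷ ds)
leadingTriple-∷ (s≤s z≤n) leadingTriple = leadingTriple

carry-∷ : ∀ d ds → ¬ LeadingTriple ds → carry (d ∷ ds) ≡ Maybe-map (d ∷_) (carry ds)
carry-∷ d (suc _ ∷ suc _ ∷ suc _ ∷ _) ¬lead = ⊥-elim (¬lead leadingTriple)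
carry-∷ d [] _ = refl
carry-∷ d (zero ∷ r) _ with carry (zero ∷ r)
... | just _  = refl
... | nothing = refl
carry-∷ d (suc x ∷ []) _ with carry (suc x ∷ [])
... | just _  = refl
... | nothing = refl
carry-∷ d (suc x ∷ zero ∷ r) _ with carry (suc x ∷ zero ∷ r)
... | just _  = refl
... | nothing = refl
carry-∷ d (suc x ∷ suc y ∷ []) _ with carry (suc x ∷ suc y ∷ [])
... | just _  = refl
... | nothing = refl
carry-∷ d (suc x ∷ suc y ∷ zero ∷ r) _ with carry (suc x ∷ suc y ∷ zero ∷ r)
... | just _  = refl
... | nothing = refl

-- The carry happens at a leftmost triple, which is therefore preceded by a 0.
carry-sound : ∀ d ds {w'} → (1 ≤ d → ¬ LeadingTriple ds) → carry (d ∷ ds) ≡ just w' → d ∷ ds ↝ w'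
carry-sound d ds leftmost eq with leadingTriple? ds
carry-sound zero    _ _        refl | yes leadingTriple = here carrying
carry-sound (suc _) _ leftmost _    | yes leadingTriple = ⊥-elim (leftmost (s≤s z≤n) leadingTriple)
carry-sound d [] _ () | no _
carry-sound d (d' ∷ ds) _ eq | no ¬lead with carry (d' ∷ ds) in e | trans (sym (carry-∷ d (d' ∷ ds) ¬lead)) eq
... | just _ | refl = there (carry-sound d' ds (λ 1≤d' → ¬lead ∘ leadingTriple-∷ 1≤d') e)

carry-nothing : ∀ d ds → carry (d ∷ ds) ≡ nothing → ¬ PosTriple ds
carry-nothing d ds eq t with leadingTriple? ds
carry-nothing d _ () _ | yes leadingTriple
... | no ¬lead with t | carry ds in e | trans (sym (carry-∷ d ds ¬lead)) eq
...   | here (s≤s _) (s≤s _) (s≤s _) | _ | _ = ¬lead leadingTriple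
...   | there {d'} {ds'} t' | nothing | refl = carry-nothing d' ds' e t'

fix2at-sound : ∀ a b x rest {w'} → 1 < x → fix2at a b x rest ≡ just w' → a ∷ b ∷ x ∷ rest ↝ w'
fix2at-sound _       _             zero          _                    ()       _
fix2at-sound _       _             (suc zero)    _                    (s≤s ()) _
fix2at-sound a       zero          (suc (suc x)) (y ∷ z ∷ e ∷ r)    _ refl = there (here fix-2a)
fix2at-sound zero    (suc zero)    (suc (suc x)) (zero ∷ z ∷ e ∷ r) _ refl = here fix-2b
fix2at-sound _       zero          _             []                   _ ()
fix2at-sound _       zero          _             (_ ∷ [])             _ ()
fix2at-sound _       zero          _             (_ ∷ _ ∷ [])         _ ()
fix2at-sound zero    (suc zero)    _             []                   _ ()
fix2at-sound zero    (suc zero)    _             (zero ∷ [])          _ ()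
fix2at-sound zero    (suc zero)    _             (zero ∷ _ ∷ [])      _ ()
fix2at-sound zero    (suc zero)    _             (suc _ ∷ _)          _ ()
fix2at-sound (suc _) (suc zero)    _             _                    _ ()
fix2at-sound zero    (suc (suc _)) _             _                    _ ()
fix2at-sound (suc _) (suc (suc _)) _             _                    _ ()

fix2-sound : ∀ a b w {w'} → fix2 a b w ≡ just w' → a ∷ b ∷ w ↝ w'
fix2-sound a b [] ()
fix2-sound a b (x ∷ rest) eq with 1 <? x
... | yes 1<x = fix2at-sound a b x rest 1<x eq
... | no _ with fix2 b x rest in e | eq
...   | just _ | refl = there (fix2-sound b x rest e)

3≤length-after-improper : ∀ {P x rest} → 1 < x → TameAt P x rest → 3 ≤ length rest
3≤length-after-improper {x = x} {rest} 1<x tx =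
  ≤-trans (*-monoʳ-≤ 3 (≤-trans (<⇒≤ 1<x) (m≤m+n x (sum rest))))
          (sparse tx (<⇒≤ 1<x) (m≤n⇒m≤1+n (boundary tx 1<x)))

fix2at-defined : ∀ a b x rest → 1 < x → ¬ PosTriple (a ∷ b ∷ x ∷ rest) → b ≤ 1 → 3 ≤ length rest →
                 ∃ λ w' → fix2at a b x rest ≡ just w'
fix2at-defined _       _             _ []                 _ _ _ ()
fix2at-defined _       _             _ (_ ∷ [])           _ _ _ (s≤s ())
fix2at-defined _       _             _ (_ ∷ _ ∷ [])       _ _ _ (s≤s (s≤s ()))
fix2at-defined a       zero          x (y ∷ z ∷ e ∷ r)    _ _ _ _ = _ , refl
fix2at-defined zero    (suc zero)    x (zero ∷ z ∷ e ∷ r) _ _ _ _ = _ , refl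
fix2at-defined zero    (suc zero)    x (suc _ ∷ _ ∷ _ ∷ _) 1<x ¬triple _ _ =
  ⊥-elim (¬triple (there (here (s≤s z≤n) (<⇒≤ 1<x) (s≤s z≤n))))
fix2at-defined (suc _) (suc zero)    x (_ ∷ _ ∷ _ ∷ _)    1<x ¬triple _ _ =
  ⊥-elim (¬triple (here (s≤s z≤n) (s≤s z≤n) (<⇒≤ 1<x)))
fix2at-defined _       (suc (suc _)) _ (_ ∷ _ ∷ _ ∷ _)    _ _ (s≤s ()) _

fix2-defined : ∀ {P} a b w → ¬ PosTriple (a ∷ b ∷ w) → b ≤ 1 → Improper w → Tame P w →
               ∃ λ w' → fix2 a b w ≡ just w'
fix2-defined a b (x ∷ rest) ¬triple b≤1 improper (tx , tame) with 1 <? x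
... | yes 1<x = fix2at-defined a b x rest 1<x ¬triple b≤1 (3≤length-after-improper 1<x tx)
... | no x≯1 with fix2-defined b x rest (¬triple ∘ there) (≮⇒≥ x≯1) (tail x≯1 improper) tame
...   | w' , e rewrite e = a ∷ w' , refl

step-sound : ∀ w {w'} → step w ≡ just w' → ∃ λ n → replicate n 0 ++ w ↝ w'
step-sound w eq with carry (0 ∷ w) in e
... | just _  = 1 , carry-sound 0 w (λ ()) (trans e eq)
... | nothing = 2 , fix2-sound 0 0 w eq

progress : ∀ {P} w → Tame P w → Canonical w ⊎ ∃ λ w' → step w ≡ just w'
progress w tame with carry (0 ∷ w) in e
... | just w' = inj₂ (w' , refl)
... | nothing with any? (2 ≤?_) w
...   | no proper    = inj₁ (All-map ≮⇒≥ (¬Any⇒All¬ w proper) , carry-nothing 0 w e)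
...   | yes improper =
  inj₂ (fix2-defined 0 0 w (¬PosTriple-0∷ (¬PosTriple-0∷ (carry-nothing 0 w e))) z≤n improper tame)

terminates : ∀ {P w} → Tame P w → Acc _<_ (potential w) → Terminates w
terminates {w = w} tame (acc smaller) with progress w tame
... | inj₁ canonical = done canonical
... | inj₂ (w' , stepped) =
  let n , rewritten = step-sound w stepped in
  next (↝⇒¬Canonical rewritten ∘ canonical-zeros n) stepped
       (terminates (↝-tame rewritten (tame-zeros n tame))
                   (smaller (subst (potential w' <_) (potential-zeros n) (↝-potential rewritten))))

¬Improper-zeros : ∀ k → ¬ Improper (replicate k 0)
¬Improper-zeros k = All¬⇒¬Any (replicate⁺ k (λ ()))

zeros≤length : ∀ u k → k ≤ length (u ++ replicate k 0)
zeros≤length u k = begin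
  k                                 ≤⟨ m≤n+m k (length u) ⟩
  length u + k                      ≡⟨ cong (length u +_) (length-replicate k) ⟨
  length u + length (replicate k 0) ≡⟨ length-++ u ⟨
  length (u ++ replicate k 0)       ∎
  where open ≤-Reasoning

tame-replicate : ∀ {P} k → Tame P (replicate k 0)
tame-replicate k = subst (Tame _) (++-identityʳ _) (tame-zeros {w = []} k tt)

-- The last component is what a positive digit put in front of w needs to be tame.
weightAcc-tame : ∀ seen u k → let w = u ++ replicate k 0 in
  Improper w → 3 * weightAcc seen w ≤ k →
  ∃ λ P → P < length w × Tame P w × (length w ≤ suc P → 3 * (seen + sum w) ≤ length w)
weightAcc-tame seen [] k improper _ = ⊥-elim (¬Improper-zeros k improper)
weightAcc-tame seen (zero ∷ u) k improper bound =
  let P , P<len , tame , _ = weightAcc-tame 0 u k (tail (λ ()) improper) bound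
  in P , m<n⇒m<1+n P<len , (tame-zero , tame) , λ len → ⊥-elim (<⇒≱ P<len (≤-pred len))
weightAcc-tame seen (suc zero ∷ u) k improper bound =
  let P , P<len , tame , start = weightAcc-tame (seen + 1) u k (tail (λ { (s≤s ()) }) improper) bound
  in P , m<n⇒m<1+n P<len ,
     (tameAt (λ { (s≤s ()) })
             (λ _ len → ≤-trans (*-monoʳ-≤ 3 (+-monoˡ-≤ _ (m≤n+m 1 seen))) (start len)) , tame) ,
     λ len → ⊥-elim (<⇒≱ P<len (≤-pred len))
weightAcc-tame seen (suc (suc x) ∷ u) k _ bound =
  length (u ++ replicate k 0) , n<1+n _ ,
  (tame-low ≤-refl (≤-trans (*-monoʳ-≤ 3 (m≤n+m _ seen)) (≤-trans bound (zeros≤length u k))) ,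
   tame-++ u (n≤1+n _) suffix-bound (tame-replicate k)) ,
  λ _ → ≤-trans bound (≤-trans (zeros≤length u k) (n≤1+n _))
  where
  suffix-bound : 3 * sum (u ++ replicate k 0) ≤ length (replicate k 0)
  suffix-bound = subst (3 * sum (u ++ replicate k 0) ≤_) (sym (length-replicate k))
    (≤-trans (*-monoʳ-≤ 3 (≤-trans (m≤n+m _ (suc (suc x))) (m≤n+m _ seen))) bound)

tame-by-weight : ∀ {k} w → Improper w → EndsInZeros k w → 3 * weight w ≤ k → ∃ λ P → Tame P w
tame-by-weight _ improper (u , refl) bound =
  let P , _ , tame , _ = weightAcc-tame 0 u _ improper bound in P , tame

mainTheorem15 : (w : List ℕ) → Improper w →
                EndsInZeros (3 * weight w) w → Terminates w
mainTheorem15 w improper endsInZeros =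
  let P , tame = tame-by-weight w improper endsInZeros ≤-refl
  in terminates tame (<-wellFounded (potential w))
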